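{- Let $\vec k=(k_1,\dots,k_\ell)$ be a vector of positive integers, $\pi\in\mathcal{D}_{\vec k}$, and $F=\eta_*(\pi)$ with first-row entries $t_1,t_2,\dots,t_\ell$ (left to right). For each $2\le j\le\ell$, let $i$ be the index of the column of $F$ containing the entry $t_j-1$ (so $i<j$), and let $m_{ij}$ be the row index of $t_j-1$ in $F$ (rows numbered $1,2,\dots$ from the top). Then the area sequence $(a_1,\dots,a_\ell)$ of $\pi$ satisfies $a_1=0$ and $a_j=a_i+k_i-m_{ij}+1$ for $j\ge2$, and the depth labeling sequence $(d_1,\dots,d_\ell)$ of $\pi$ satisfies $d_1=0$ and $d_j=d_i+m_{ij}-1$ for $j\ge2$.
   Context: Let $N=|\vec k|+\ell$. A $\vec{k}$-Dyck path is a word $\pi=\pi_1\cdots\pi_N$ consisting of the letters $S^{k_1},\dots,S^{k_\ell}$, each exactly once and in this order from left to right, together with $|\vec k|$ letters $W$, such that the starting ranks $r_1=0$, $r_{i+1}=r_i+k_j$ if $\pi_i=S^{k_j}$, $r_{i+1}=r_i-1$ if $\pi_i=W$, are all nonnegative. $\mathcal{D}_{\vec k}$ is the set of $\vec k$-Dyck paths. The area sequence is $(a_1,\dots,a_\ell)$ with $a_j=r_i$ for the index $i$ with $\pi_i=S^{k_j}$. Filling algorithm $\eta_*$: in a tableau of $\ell$ top-justified columns, column $i$ with $k_i+1$ cells, place $1,\dots,N$ successively: $1$ at the top of column 1; for $i\ge2$, if $\pi_i$ is an $S$-letter put $i$ at the top of the leftmost empty column, and if $\pi_i=W$ put $i$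 immediately below the largest active entry (an entry is active if it is currently the bottom-most entry of its column $j$ and that column has fewer than $k_j+1$ entries). Ranking: column 1 gets ranks $0,1,\dots,k_1$ top to bottom; for $i\ge2$, if the top entry of column $i$ is $A+1$ and $A$ has rank $\alpha$, column $i$ gets ranks $\alpha,\dots,\alpha+k_i$ top to bottom. The depth labeling sequence $(d_1,\dots,d_\ell)$ consists of the ranks of the first-row cells of $\eta_*(\pi)$. -}

module Defs where

open import Data.Nat using (ℕ; zero; suc; _+_; _∸_; _<_; _≤_; _<ᵇ_; _≡ᵇ_; _⊔_)
open import Data.Integer using (ℤ; +_) renaming (_+_ to _+ℤ_; _-_ to _-ℤ_; _≤_ to _≤ℤ_)
open import Data.List using (List; []; _∷_; _++_; length; replicate)
open import Data.Nat.ListAction using (sum)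
open import Data.List.Relation.Unary.All using (All)
open import Data.Maybe using (Maybe; just; nothing; maybe)
open import Data.Bool using (Bool; true; false; if_then_else_)
open import Data.Product using (_×_; _,_)
open import Relation.Binary.PropositionalEquality using (_≡_)

-- Words.  The letters S^{k_1},…,S^{k_ℓ} occur exactly once and in this
-- order, so a word is encoded as a word in {S, W}: the j-th occurrence
-- of S (from the left) stands for the letter S^{k_j}.

data Letter : Set where
  S W : Letter

countS : List Letter → ℕ
countS []      = 0
countS (S ∷ π) = suc (countS π)
countS (W ∷ π) = countS π

countW : List Letter → ℕ
countW []      = 0
countW (S ∷ π) = countW π
countW (W ∷ π) = suc (countW π)

-- starting ranks r_1, r_2, …, r_{N+1} of π, starting from rank r
-- (the list ks holds the exponents k_j of the S-letters not yet read).
-- The clause for an S with no exponent left never occurs when countS π = ℓ.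
ranks : ℤ → List ℕ → List Letter → List ℤ
ranks r ks       []      = r ∷ []
ranks r []       (S ∷ π) = r ∷ ranks r [] π
ranks r (k ∷ ks) (S ∷ π) = r ∷ ranks (r +ℤ + k) ks π
ranks r ks       (W ∷ π) = r ∷ ranks (r -ℤ + 1) ks π

IsDyck : List ℕ → List Letter → Set
IsDyck k π = (countS π ≡ length k) × (countW π ≡ sum k)
           × All (λ r → + 0 ≤ℤ r) (ranks (+ 0) k π)

-- area sequence (a_1,…,a_ℓ): a_j is the starting rank of the letter S^{k_j}
areaSeq : ℤ → List ℕ → List Letter → List ℤ
areaSeq r ks       []      = []
areaSeq r []       (S ∷ π) = areaSeq r [] π
areaSeq r (k ∷ ks) (S ∷ π) = r ∷ areaSeq (r +ℤ + k) ks π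
areaSeq r ks       (W ∷ π) = areaSeq (r -ℤ + 1) ks π

nth : {A : Set} → List A → ℕ → Maybe A
nth []       _       = nothing
nth (x ∷ xs) zero    = just x
nth (x ∷ xs) (suc n) = nth xs n

-- lookup with a default value (only used at indices < ℓ, where the
-- lists involved have length ℓ for Dyck paths)
at : {A : Set} → A → List A → ℕ → A
at d xs n = maybe (λ x → x) d (nth xs n)

lastM : List ℕ → Maybe ℕ
lastM []       = nothing
lastM (x ∷ []) = just x
lastM (x ∷ xs) = lastM xs

maxM : Maybe ℕ → Maybe ℕ → Maybe ℕ
maxM nothing  m        = m
maxM (just a) nothing  = just a
maxM (just a) (just b) = just (a ⊔ b)

-- Tableaux: a list of ℓ columns, each column listed top to bottom.

Tableau : Set
Tableau = List (List ℕ)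

largestActive : List ℕ → Tableau → Maybe ℕ
largestActive (k ∷ ks) (c ∷ cs) =
  maxM (if length c <ᵇ suc k then lastM c else nothing) (largestActive ks cs)
largestActive _ _ = nothing

placeBelow : ℕ → ℕ → Tableau → Tableau
placeBelow e i [] = []
placeBelow e i (c ∷ cs) with lastM c
... | just x = (if x ≡ᵇ e then c ++ (i ∷ []) else c) ∷ placeBelow e i cs
... | nothing = c ∷ placeBelow e i cs

placeTop : ℕ → Tableau → Tableau
placeTop i []            = []
placeTop i ([] ∷ cs)     = (i ∷ []) ∷ cs
placeTop i ((x ∷ c) ∷ cs) = (x ∷ c) ∷ placeTop i cs

placeTopCol1 : ℕ → Tableau → Tableau
placeTopCol1 i []       = []
placeTopCol1 i (c ∷ cs) = (i ∷ c) ∷ cs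

step : List ℕ → ℕ → Letter → Tableau → Tableau
step ks 1 x F = placeTopCol1 1 F
step ks i S F = placeTop i F
step ks i W F = maybe (λ e → placeBelow e i F) F (largestActive ks F)

fillFrom : List ℕ → ℕ → List Letter → Tableau → Tableau
fillFrom ks i []      F = F
fillFrom ks i (x ∷ π) F = fillFrom ks (suc i) π (step ks i x F)

fill : List ℕ → List Letter → Tableau
fill k π = fillFrom k 1 π (replicate (length k) [])

-- entry of F in column c (0-based, left to right) and row m
-- (1-based, rows numbered from the top)
cellAt : Tableau → ℕ → ℕ → Maybe ℕ
cellAt F c zero    = nothing
cellAt F c (suc m) = maybe (λ col → nth col m) nothing (nth F c)

-- position (column (0-based), row (1-based)) of an entry x
locateIn : ℕ → ℕ → List ℕ → Maybe ℕ
locateIn x m []       = nothing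
locateIn x m (y ∷ ys) = if y ≡ᵇ x then just m else locateIn x (suc m) ys

locate : ℕ → ℕ → Tableau → Maybe (ℕ × ℕ)
locate x c []       = nothing
locate x c (col ∷ F) with locateIn x 1 col
... | just m  = just (c , m)
... | nothing = locate x (suc c) F

-- Ranking.  topRanks F n = ranks of the top cells of columns 0,…,n-1.
-- Column 0 gets ranks 0,1,…; column n ≥ 1 with top entry A+1, where A
-- sits in column c < n at row m, gets top rank
--   rank(A) = (top rank of column c) + (m - 1).
-- (The fallback value 0 is never used for Dyck paths.)

topRank : Tableau → List ℕ → ℕ → ℕ
topRank F acc zero    = 0
topRank F acc (suc n) with cellAt F (suc n) 1
... | nothing = 0
... | just t with locate (t ∸ 1) 0 F
...   | nothing = 0
...   | just (c , m) = if c <ᵇ suc n then at 0 acc c + (m ∸ 1) else 0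

topRanks : Tableau → ℕ → List ℕ
topRanks F zero    = []
topRanks F (suc n) = topRanks F n ++ (topRank F (topRanks F n) n ∷ [])

depthSeq : List ℕ → List Letter → List ℕ
depthSeq k π = topRanks (fill k π) (length k)

-- a_j and d_j with 0-based index j (paper index j+1)
area : List ℕ → List Letter → ℕ → ℤ
area k π j = at (+ 0) (areaSeq (+ 0) k π) j

depth : List ℕ → List Letter → ℕ → ℕ
depth k π j = at 0 (depthSeq k π) j

-- Entry x of the filling is the index of the letter π_x. Reading π letter by letter, we keep the
-- invariant that an entry x in row m + 1 of column c satisfies r_{x+1} = a_c + k_c − m, and that
-- the top entry t of column c satisfies r_t = a_c. The columns that can still grow form a stack:
-- their rank intervals [a_c, r_{e+1}], e the bottom entry, start at 0, abut one another and end at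
-- the current rank. Hence the largest active entry is the one at the current rank, and a W placed
-- below it preserves the invariant. In the final filling, if t_j − 1 lies in row m of column i,
-- then a_j = r_{t_j} = a_i + k_i − m + 1; i < j because the tops increase from left to right, and
-- the depth recurrence is the ranking rule once t_j − 1 is located uniquely.

{-# OPTIONS --safe #-}
module Submission where

open import Defs
open import Data.Nat using (ℕ; zero; suc; _+_; _∸_; _<_; _≤_; _<ᵇ_; _≡ᵇ_; _⊔_; z≤n; s≤s; _<?_)
import Data.Nat.Properties as ℕ
open import Data.Integer using (ℤ; +_; -[1+_]; +<+) renaming (_+_ to _+ℤ_; _-_ to _-ℤ_; _≤_ to _≤ℤ_; _<_ to _<ℤ_)
import Data.Integer.Properties as ℤ
open import Data.Integer.Tactic.RingSolver using (solve-∀)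
open import Data.List using (List; []; _∷_; _++_; _∷ʳ_; length; drop; replicate)
open import Data.List.Properties using (length-++; length-replicate)
open import Data.List.Relation.Unary.All using (All; []; _∷_)
open import Data.Maybe using (just; nothing; maybe)
open import Data.Maybe.Properties using (just-injective)
open import Data.Bool using (true; false; if_then_else_)
open import Data.Bool.Properties using (T-≡)
open import Data.Empty using (⊥-elim)
open import Data.Sum using (_⊎_; inj₁; inj₂)
open import Data.Product using (_×_; Σ; ∃; ∃₂; _,_; proj₁; proj₂)
open import Function using (_∘_)
open import Function.Bundles using (Equivalence)
open import Relation.Binary.PropositionalEquality using (_≡_; _≢_; refl; sym; trans; cong; subst; module ≡-Reasoning)
open import Relation.Nullary using (¬_; yes; no)
open import Relation.Binary.Definitions using (tri<; tri≈; tri>)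

≡ᵇ-refl : ∀ n → (n ≡ᵇ n) ≡ true
≡ᵇ-refl n = Equivalence.to T-≡ (ℕ.≡⇒≡ᵇ n n refl)

≢⇒≡ᵇ-false : ∀ {m n} → m ≢ n → (m ≡ᵇ n) ≡ false
≢⇒≡ᵇ-false {m} {n} m≢n with m ≡ᵇ n in eq
... | true  = ⊥-elim (m≢n (ℕ.≡ᵇ⇒≡ m n (Equivalence.from T-≡ eq)))
... | false = refl

module _ {A : Set} where

  nth-++ˡ : ∀ (xs ys : List A) {m x} → nth xs m ≡ just x → nth (xs ++ ys) m ≡ just x
  nth-++ˡ []       ys         ()
  nth-++ˡ (y ∷ xs) ys {zero}  eq = eq
  nth-++ˡ (y ∷ xs) ys {suc m} eq = nth-++ˡ xs ys eq

  nth-++-< : ∀ (xs ys : List A) {m} → m < length xs → nth (xs ++ ys) m ≡ nth xs m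
  nth-++-< (x ∷ xs) ys {zero}  _         = refl
  nth-++-< (x ∷ xs) ys {suc m} (s≤s m<n) = nth-++-< xs ys m<n

  nth-++-length : ∀ (xs : List A) y ys → nth (xs ++ y ∷ ys) (length xs) ≡ just y
  nth-++-length []       y ys = refl
  nth-++-length (x ∷ xs) y ys = nth-++-length xs y ys

  nth-∷ʳ⁻ : ∀ (xs : List A) y {m x} → nth (xs ∷ʳ y) m ≡ just x →
            nth xs m ≡ just x ⊎ (m ≡ length xs × x ≡ y)
  nth-∷ʳ⁻ []       y {zero}  refl = inj₂ (refl , refl)
  nth-∷ʳ⁻ []       y {suc m} ()
  nth-∷ʳ⁻ (z ∷ xs) y {zero}  eq   = inj₁ eq
  nth-∷ʳ⁻ (z ∷ xs) y {suc m} eq with nth-∷ʳ⁻ xs y eq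
  ... | inj₁ old            = inj₁ old
  ... | inj₂ (m≡len , x≡y) = inj₂ (cong suc m≡len , x≡y)

  length-∷ʳ : ∀ (xs : List A) y → length (xs ∷ʳ y) ≡ suc (length xs)
  length-∷ʳ []       y = refl
  length-∷ʳ (x ∷ xs) y = cong suc (length-∷ʳ xs y)

  drop-∷ : ∀ d n (xs : List A) {y ys} → drop n xs ≡ y ∷ ys → at d xs n ≡ y × drop (suc n) xs ≡ ys
  drop-∷ d zero    (x ∷ xs) refl = refl , refl
  drop-∷ d (suc n) []       ()
  drop-∷ d (suc n) (x ∷ xs) eq   = drop-∷ d n xs eq

  drop-∷⇒< : ∀ n (xs : List A) {y ys} → drop n xs ≡ y ∷ ys → n < length xs
  drop-∷⇒< zero    (x ∷ xs) refl = s≤s z≤n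
  drop-∷⇒< (suc n) []       ()
  drop-∷⇒< (suc n) (x ∷ xs) eq   = s≤s (drop-∷⇒< n xs eq)

  drop-[]⇒≤ : ∀ n (xs : List A) → drop n xs ≡ [] → length xs ≤ n
  drop-[]⇒≤ zero    []       _  = z≤n
  drop-[]⇒≤ (suc n) []       _  = z≤n
  drop-[]⇒≤ (suc n) (x ∷ xs) eq = s≤s (drop-[]⇒≤ n xs eq)

lastM-∷ʳ : ∀ xs y → lastM (xs ∷ʳ y) ≡ just y
lastM-∷ʳ []           y = refl
lastM-∷ʳ (x ∷ [])     y = refl
lastM-∷ʳ (x ∷ z ∷ xs) y = lastM-∷ʳ (z ∷ xs) y

lastM⇒nth : ∀ xs {e} → lastM xs ≡ just e → ∃ λ m → suc m ≡ length xs × nth xs m ≡ just e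
lastM⇒nth (x ∷ [])     refl = 0 , refl , refl
lastM⇒nth (x ∷ z ∷ xs) eq with lastM⇒nth (z ∷ xs) eq
... | m , len , at-m = suc m , cong suc len , at-m

private
  +[1+b+c]-1+b≡+c : ∀ (a b c : ℤ) → a +ℤ c ≡ ((a +ℤ (b +ℤ c)) -ℤ (+ 1 +ℤ b)) +ℤ + 1
  +[1+b+c]-1+b≡+c = solve-∀

  +[1+c]-1≡+c : ∀ (a c : ℤ) → (a +ℤ (+ 1 +ℤ c)) -ℤ + 1 ≡ a +ℤ c
  +[1+c]-1≡+c = solve-∀

i+[k∸m]≡i+k-[1+m]+1 : ∀ (i : ℤ) {k m} → m ≤ k → i +ℤ + (k ∸ m) ≡ ((i +ℤ + k) -ℤ + suc m) +ℤ + 1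
i+[k∸m]≡i+k-[1+m]+1 i {k} {m} m≤k =
  subst (λ n → i +ℤ + (k ∸ m) ≡ ((i +ℤ + n) -ℤ + suc m) +ℤ + 1) (ℕ.m+[n∸m]≡n m≤k)
        (+[1+b+c]-1+b≡+c i (+ m) (+ (k ∸ m)))

i+[1+n]-1≡i+n : ∀ (i : ℤ) n → (i +ℤ + suc n) -ℤ + 1 ≡ i +ℤ + n
i+[1+n]-1≡i+n i n = +[1+c]-1≡+c i (+ n)

i<i+[1+n] : ∀ (i : ℤ) n → i <ℤ i +ℤ + suc n
i<i+[1+n] i n = subst (_<ℤ i +ℤ + suc n) (ℤ.+-identityʳ i) (ℤ.+-monoʳ-< i (+<+ (s≤s z≤n)))

0≤i-1⇒0<i : ∀ i → + 0 ≤ℤ i -ℤ + 1 → + 0 <ℤ i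
0≤i-1⇒0<i (+ suc n) _ = +<+ (s≤s z≤n)
0≤i-1⇒0<i (+ zero)  ()
0≤i-1⇒0<i -[1+ n ]  ()

k∸m≡1+k∸[1+m] : ∀ {k m} → m < k → k ∸ m ≡ suc (k ∸ suc m)
k∸m≡1+k∸[1+m] {suc k} (s≤s m≤k) = ℕ.+-∸-assoc 1 m≤k

col : Tableau → ℕ → List ℕ
col []      c       = []
col (x ∷ F) zero    = x
col (x ∷ F) (suc c) = col F c

-- Rows are 0-based here, whereas cellAt numbers them from 1.
Cell : Tableau → ℕ → ℕ → ℕ → Set
Cell F c m x = nth (col F c) m ≡ just x

cellAt≡nth-col : ∀ F c m → cellAt F c (suc m) ≡ nth (col F c) m
cellAt≡nth-col []      c       m = refl
cellAt≡nth-col (x ∷ F) zero    m = refl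
cellAt≡nth-col (x ∷ F) (suc c) m = cellAt≡nth-col F c m

col-replicate : ∀ n c → col (replicate n []) c ≡ []
col-replicate zero    c       = refl
col-replicate (suc n) zero    = refl
col-replicate (suc n) (suc c) = col-replicate n c

¬Cell-[] : ∀ F c {m x} → col F c ≡ [] → ¬ Cell F c m x
¬Cell-[] F c c≡[] q with col F c
¬Cell-[] F c refl () | []

Active : List ℕ → Tableau → ℕ → ℕ → Set
Active ks F c e = lastM (col F c) ≡ just e × length (col F c) < suc (at 0 ks c)

record ActiveCell (ks : List ℕ) (F : Tableau) (c e : ℕ) : Set where
  field
    row     : ℕ
    bottom  : suc row ≡ length (col F c)
    cell    : Cell F c row e
    row<    : row < at 0 ks c

active⇒ActiveCell : ∀ ks F c {e} → Active ks F c e → ActiveCell ks F c e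
active⇒ActiveCell ks F c (last , room) with lastM⇒nth (col F c) last
... | m , len , cell = record
  { row = m ; bottom = len ; cell = cell ; row< = ℕ.≤-pred (subst (_< suc (at 0 ks c)) (sym len) room) }

record Appended (F G : Tableau) (c₀ i : ℕ) : Set where
  field
    appended : col G c₀ ≡ col F c₀ ∷ʳ i
    unchanged : ∀ c → c ≢ c₀ → col G c ≡ col F c

module AppendedCells {F G : Tableau} {c₀ i : ℕ} (G≈F+i : Appended F G c₀ i) where
  open Appended G≈F+i

  Cell⁻ : ∀ c m x → Cell G c m x → Cell F c m x ⊎ (c ≡ c₀ × m ≡ length (col F c₀) × x ≡ i)
  Cell⁻ c m x q with c ℕ.≟ c₀
  ... | no c≢c₀ = inj₁ (subst (λ xs → nth xs m ≡ just x) (unchanged c c≢c₀) q)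
  ... | yes refl with nth-∷ʳ⁻ (col F c₀) i (subst (λ xs → nth xs m ≡ just x) appended q)
  ...   | inj₁ old            = inj₁ old
  ...   | inj₂ (m≡len , x≡i) = inj₂ (refl , m≡len , x≡i)

  Cell⁺ : ∀ c m x → Cell F c m x → Cell G c m x
  Cell⁺ c m x q with c ℕ.≟ c₀
  ... | yes refl = subst (λ xs → nth xs m ≡ just x) (sym appended) (nth-++ˡ (col F c₀) (i ∷ []) q)
  ... | no c≢c₀  = subst (λ xs → nth xs m ≡ just x) (sym (unchanged c c≢c₀)) q

  Cell-new : Cell G c₀ (length (col F c₀)) i
  Cell-new = subst (λ xs → nth xs (length (col F c₀)) ≡ just i) (sym appended) (nth-++-length (col F c₀) i [])

  module _ (ks : List ℕ) where

    Active⁻ : ∀ c e → Active ks G c e →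
              (c ≢ c₀ × Active ks F c e) ⊎ (c ≡ c₀ × e ≡ i)
    Active⁻ c e (last , room) with c ℕ.≟ c₀
    ... | no c≢c₀ = inj₁ (c≢c₀ , subst (λ xs → lastM xs ≡ just e) (unchanged c c≢c₀) last
                                   , subst (λ xs → length xs < suc (at 0 ks c)) (unchanged c c≢c₀) room)
    ... | yes refl = inj₂ (refl , just-injective (trans (sym (subst (λ xs → lastM xs ≡ just e) appended last))
                                                       (lastM-∷ʳ (col F c₀) i)))

    Active⁺ : ∀ c e → Active ks F c e → c ≢ c₀ → Active ks G c e
    Active⁺ c e (last , room) c≢c₀ =
      subst (λ xs → lastM xs ≡ just e) (sym (unchanged c c≢c₀)) last ,
      subst (λ xs → length xs < suc (at 0 ks c)) (sym (unchanged c c≢c₀)) room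

    Active-new : suc (length (col F c₀)) < suc (at 0 ks c₀) → Active ks G c₀ i
    Active-new room =
      subst (λ xs → lastM xs ≡ just i) (sym appended) (lastM-∷ʳ (col F c₀) i) ,
      subst (λ xs → length xs < suc (at 0 ks c₀)) (sym appended)
            (subst (_< suc (at 0 ks c₀)) (sym (length-∷ʳ (col F c₀) i)) room)

placeTop-appended : ∀ i F s → (∀ c → c < s → col F c ≢ []) → col F s ≡ [] → s < length F →
                    Appended F (placeTop i F) s i
placeTop-appended i ([] ∷ F) zero _ _ _ = record
  { appended = refl ; unchanged = λ { zero 0≢0 → ⊥-elim (0≢0 refl) ; (suc c) _ → refl } }
placeTop-appended i ([] ∷ F) (suc s) nonempty _ _ = ⊥-elim (nonempty zero (s≤s z≤n) refl)
placeTop-appended i ((y ∷ ys) ∷ F) (suc s) nonempty empty (s≤s s<len) = record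
  { appended  = appended
  ; unchanged = λ { zero _ → refl ; (suc c) c≢s → unchanged c (λ c≡s → c≢s (cong suc c≡s)) } }
  where open Appended (placeTop-appended i F s (λ c c<s → nonempty (suc c) (s≤s c<s)) empty s<len)

length-placeTop : ∀ i F → length (placeTop i F) ≡ length F
length-placeTop i []            = refl
length-placeTop i ([] ∷ F)      = refl
length-placeTop i ((x ∷ c) ∷ F) = cong suc (length-placeTop i F)

appendBelow : ℕ → ℕ → List ℕ → List ℕ
appendBelow e i xs with lastM xs
... | just x  = if x ≡ᵇ e then xs ∷ʳ i else xs
... | nothing = xs

col-placeBelow : ∀ e i F c → col (placeBelow e i F) c ≡ appendBelow e i (col F c)
col-placeBelow e i []      c = refl
col-placeBelow e i (x ∷ F) zero with lastM x
... | just _  = refl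
... | nothing = refl
col-placeBelow e i (x ∷ F) (suc c) with lastM x
... | just _  = col-placeBelow e i F c
... | nothing = col-placeBelow e i F c

length-placeBelow : ∀ e i F → length (placeBelow e i F) ≡ length F
length-placeBelow e i []      = refl
length-placeBelow e i (x ∷ F) with lastM x
... | just _  = cong suc (length-placeBelow e i F)
... | nothing = cong suc (length-placeBelow e i F)

appendBelow-last : ∀ e i xs → lastM xs ≡ just e → appendBelow e i xs ≡ xs ∷ʳ i
appendBelow-last e i xs last with lastM xs
appendBelow-last e i xs refl | just .e rewrite ≡ᵇ-refl e = refl

appendBelow-¬last : ∀ e i xs → (∀ y → lastM xs ≡ just y → y ≢ e) → appendBelow e i xs ≡ xs
appendBelow-¬last e i xs ¬last with lastM xs
... | nothing = refl
... | just y rewrite ≢⇒≡ᵇ-false (¬last y refl) = refl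

placeBelow-appended : ∀ e i F c₀ → (∀ c m → Cell F c m e → c ≡ c₀) → lastM (col F c₀) ≡ just e →
                      Appended F (placeBelow e i F) c₀ i
placeBelow-appended e i F c₀ only-c₀ last = record
  { appended  = trans (col-placeBelow e i F c₀) (appendBelow-last e i (col F c₀) last)
  ; unchanged = λ c c≢c₀ → trans (col-placeBelow e i F c) (appendBelow-¬last e i (col F c) (λ y last-y y≡e →
      let m , _ , cell = lastM⇒nth (col F c) last-y
      in c≢c₀ (only-c₀ c m (subst (λ z → Cell F c m z) y≡e cell))))
  }

maxM-just⁻ : ∀ a b {e} → maxM a b ≡ just e → a ≡ just e ⊎ b ≡ just e
maxM-just⁻ nothing  b        eq = inj₂ eq
maxM-just⁻ (just x) nothing  eq = inj₁ eq
maxM-just⁻ (just x) (just y) eq with ℕ.⊔-sel x y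
... | inj₁ x⊔y≡x = inj₁ (trans (cong just (sym x⊔y≡x)) eq)
... | inj₂ x⊔y≡y = inj₂ (trans (cong just (sym x⊔y≡y)) eq)

maxM-just-≤ˡ : ∀ x b → ∃ λ e → maxM (just x) b ≡ just e × x ≤ e
maxM-just-≤ˡ x nothing  = x , refl , ℕ.≤-refl
maxM-just-≤ˡ x (just y) = x ⊔ y , refl , ℕ.m≤m⊔n x y

maxM-just-≤ʳ : ∀ a y → ∃ λ e → maxM a (just y) ≡ just e × y ≤ e
maxM-just-≤ʳ nothing  y = y , refl , ℕ.≤-refl
maxM-just-≤ʳ (just x) y = x ⊔ y , refl , ℕ.m≤n⊔m x y

largestActive-active : ∀ ks F {e} → largestActive ks F ≡ just e → ∃ λ c → Active ks F c e
largestActive-active []       F       ()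
largestActive-active (k ∷ ks) []      ()
largestActive-active (k ∷ ks) (x ∷ F) eq with length x <ᵇ suc k in room
... | false with largestActive-active ks F eq
...   | c , active = suc c , active
largestActive-active (k ∷ ks) (x ∷ F) eq | true with maxM-just⁻ (lastM x) (largestActive ks F) eq
...   | inj₁ last = zero , last , ℕ.<ᵇ⇒< _ _ (Equivalence.from T-≡ room)
...   | inj₂ rest with largestActive-active ks F rest
...     | c , active = suc c , active

active≤largestActive : ∀ ks F c {e′} → Active ks F c e′ → ∃ λ e → largestActive ks F ≡ just e × e′ ≤ e
active≤largestActive ks       []       c       (() , _)
active≤largestActive []       ([] ∷ F) zero    (() , _)
active≤largestActive []       ((y ∷ ys) ∷ F) zero (_ , s≤s ())
active≤largestActive []       (x ∷ F)  (suc c) active with active≤largestActive [] F c active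
... | _ , () , _
active≤largestActive (k ∷ ks) (x ∷ F)  zero    {e′} (last , room)
  rewrite Equivalence.to T-≡ (ℕ.<⇒<ᵇ room) | last = maxM-just-≤ˡ e′ (largestActive ks F)
active≤largestActive (k ∷ ks) (x ∷ F)  (suc c) active with active≤largestActive ks F c active
... | e , eq , e′≤e with maxM-just-≤ʳ (if length x <ᵇ suc k then lastM x else nothing) e
...   | e₂ , eq₂ , e≤e₂ rewrite eq = e₂ , eq₂ , ℕ.≤-trans e′≤e e≤e₂

locateIn-just : ∀ x m ys {m′} → locateIn x m ys ≡ just m′ → ∃ λ j → m′ ≡ m + j × nth ys j ≡ just x
locateIn-just x m []       ()
locateIn-just x m (y ∷ ys) eq with y ≡ᵇ x in y≡ᵇx
... | true  = 0 , trans (sym (just-injective eq)) (sym (ℕ.+-identityʳ m))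
                , cong just (ℕ.≡ᵇ⇒≡ y x (Equivalence.from T-≡ y≡ᵇx))
... | false with locateIn-just x (suc m) ys eq
...   | j , m′≡ , at-j = suc j , trans m′≡ (sym (ℕ.+-suc m j)) , at-j

locateIn-nothing : ∀ x m ys → locateIn x m ys ≡ nothing → ∀ j → nth ys j ≢ just x
locateIn-nothing x m []       _  j ()
locateIn-nothing x m (y ∷ ys) eq j at-j with y ≡ᵇ x in y≡ᵇx
locateIn-nothing x m (y ∷ ys) () j at-j | true
locateIn-nothing x m (y ∷ ys) eq zero at-0 | false rewrite just-injective at-0 | ≡ᵇ-refl x with y≡ᵇx
... | ()
locateIn-nothing x m (y ∷ ys) eq (suc j) at-j | false = locateIn-nothing x (suc m) ys eq j at-j

locate-just : ∀ x c F {c′ m′} → locate x c F ≡ just (c′ , m′) →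
              ∃ λ d → c′ ≡ c + d × ∃ λ j → m′ ≡ suc j × Cell F d j x
locate-just x c []         ()
locate-just x c (col₀ ∷ F) eq with locateIn x 1 col₀ in found
... | just m with eq
...   | refl with locateIn-just x 1 col₀ found
...     | j , m≡ , at-j = 0 , sym (ℕ.+-identityʳ c) , j , m≡ , at-j
locate-just x c (col₀ ∷ F) eq | nothing with locate-just x (suc c) F eq
...   | d , c′≡ , j , m′≡ , cell = suc d , trans c′≡ (sym (ℕ.+-suc c d)) , j , m′≡ , cell

locate-nothing : ∀ x c F → locate x c F ≡ nothing → ∀ d j → ¬ Cell F d j x
locate-nothing x c []         _  d j ()
locate-nothing x c (col₀ ∷ F) eq d j cell with locateIn x 1 col₀ in found
locate-nothing x c (col₀ ∷ F) () d j cell | just m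
locate-nothing x c (col₀ ∷ F) eq zero    j cell | nothing = locateIn-nothing x 1 col₀ found j cell
locate-nothing x c (col₀ ∷ F) eq (suc d) j cell | nothing = locate-nothing x (suc c) F eq d j cell

length-topRanks : ∀ F n → length (topRanks F n) ≡ n
length-topRanks F zero    = refl
length-topRanks F (suc n) =
  trans (length-++ (topRanks F n)) (trans (ℕ.+-comm (length (topRanks F n)) 1) (cong suc (length-topRanks F n)))

at-topRanks : ∀ F j n → j < n → at 0 (topRanks F n) j ≡ topRank F (topRanks F j) j
at-topRanks F j (suc n) (s≤s j≤n) with ℕ.m≤n⇒m<n∨m≡n j≤n
... | inj₁ j<n =
  trans (cong (maybe (λ x → x) 0) (nth-++-< (topRanks F n) _ (subst (j <_) (sym (length-topRanks F n)) j<n)))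
        (at-topRanks F j n j<n)
... | inj₂ refl = subst (λ z → at 0 (topRanks F j ++ topRank F (topRanks F j) j ∷ []) z ≡ topRank F (topRanks F j) j)
                        (length-topRanks F j) (cong (maybe (λ x → x) 0) (nth-++-length (topRanks F j) _ []))

topRank-located : ∀ F acc n {t c m} → cellAt F (suc n) 1 ≡ just t → locate (t ∸ 1) 0 F ≡ just (c , m) →
                  c < suc n →
                  topRank F acc (suc n) ≡ at 0 acc c + (m ∸ 1)
topRank-located F acc n top found c≤n rewrite top | found | Equivalence.to T-≡ (ℕ.<⇒<ᵇ c≤n) = refl

ranks-head : ∀ r ks π → ∃ λ rs → ranks r ks π ≡ r ∷ rs
ranks-head r ks       []      = _ , refl
ranks-head r []       (S ∷ π) = _ , refl
ranks-head r (k ∷ ks) (S ∷ π) = _ , refl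
ranks-head r []       (W ∷ π) = _ , refl
ranks-head r (k ∷ ks) (W ∷ π) = _ , refl

ranks-W : ∀ r ks π → ranks r ks (W ∷ π) ≡ r ∷ ranks (r -ℤ + 1) ks π
ranks-W r []       π = refl
ranks-W r (k ∷ ks) π = refl

areaSeq-W : ∀ r ks π → areaSeq r ks (W ∷ π) ≡ areaSeq (r -ℤ + 1) ks π
areaSeq-W r []       π = refl
areaSeq-W r (k ∷ ks) π = refl

All-ranks-W : ∀ r ks π → All (+ 0 ≤ℤ_) (ranks r ks (W ∷ π)) →
              + 0 <ℤ r × All (+ 0 ≤ℤ_) (ranks (r -ℤ + 1) ks π)
All-ranks-W r ks π nonneg with subst (All (+ 0 ≤ℤ_)) (ranks-W r ks π) nonneg
... | _ ∷ rest with subst (All (+ 0 ≤ℤ_)) (proj₂ (ranks-head (r -ℤ + 1) ks π)) rest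
...   | r-1≥0 ∷ _ = 0≤i-1⇒0<i r r-1≥0 , rest

area-first : ∀ k π → countS π ≡ length k → All (+ 0 ≤ℤ_) (ranks (+ 0) k π) → 0 < length k →
             area k π 0 ≡ + 0
area-first []        π       _  _      ()
area-first (k₁ ∷ ks) []      () _      _
area-first (k₁ ∷ ks) (S ∷ π) _  _      _ = refl
area-first (k₁ ∷ ks) (W ∷ π) _  nonneg _ with +<+ () ← proj₁ (All-ranks-W (+ 0) (k₁ ∷ ks) π nonneg)

-- Entry 1 is placed by a separate clause of step, which agrees with placeTop while column 1 is empty.
step-S : ∀ k p F → (p ≡ 0 → col F 0 ≡ []) → step k (suc p) S F ≡ placeTop (suc p) F
step-S k zero    []            _     = refl
step-S k zero    ([] ∷ F)      _     = refl
step-S k zero    ((x ∷ c) ∷ F) empty with () ← empty refl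
step-S k (suc p) F             _     = refl

step-W : ∀ k p F {e} → 1 ≤ p → largestActive k F ≡ just e → step k (suc p) W F ≡ placeBelow e (suc p) F
step-W k (suc p) F _ largest rewrite largest = refl

module Filling (k : List ℕ) (π : List Letter) where

  κ : ℕ → ℕ
  κ c = at 0 k c

  -- ρ x is the rank after the first x letters of π, the paper's r_{x+1}.
  ρ : ℕ → ℤ
  ρ x = at (+ 0) (ranks (+ 0) k π) x

  a : ℕ → ℤ
  a c = area k π c

  Act : Tableau → ℕ → ℕ → Set
  Act = Active k

  record CellSpec (p s c m x : ℕ) : Set where
    field
      column< : c < s
      row≤    : m ≤ κ c
      1≤entry : 1 ≤ x
      entry≤  : x ≤ p
      rank    : ρ x ≡ a c +ℤ + (κ c ∸ m)

  CellSpec-mono : ∀ {p p′ s s′ c m x} → p ≤ p′ → s ≤ s′ → CellSpec p s c m x → CellSpec p′ s′ c m x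
  CellSpec-mono p≤p′ s≤s′ spec = record
    { column< = ℕ.<-≤-trans column< s≤s′
    ; row≤    = row≤
    ; 1≤entry = 1≤entry
    ; entry≤  = ℕ.≤-trans entry≤ p≤p′
    ; rank    = rank
    }
    where open CellSpec spec

  -- The state after p letters, s of them S, at current rank r.
  record Invariant (p s : ℕ) (r : ℤ) (F : Tableau) : Set where
    field
      width           : length F ≡ length k
      s≤p             : s ≤ p
      empty           : ∀ c → s ≤ c → col F c ≡ []
      top             : ∀ c → c < s → ∃ (Cell F c 0)
      cellSpec        : ∀ c m x → Cell F c m x → CellSpec p s c m x
      top-area        : ∀ c t → Cell F c 0 t → a c ≡ ρ (t ∸ 1)
      tops-increasing : ∀ c c′ t t′ → c < c′ → Cell F c 0 t → Cell F c′ 0 t′ → t < t′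
      top-least       : ∀ c m t x → Cell F c 0 t → Cell F c m x → t ≤ x
      placed          : ∀ x → 1 ≤ x → x ≤ p → ∃₂ λ c m → Cell F c m x
      unique          : ∀ c m c′ m′ x → Cell F c m x → Cell F c′ m′ x → c ≡ c′ × m ≡ m′
      -- The active columns form a stack: from left to right their rank intervals [a c, ρ e]
      -- start at 0, abut one another and end at the current rank r.
      active-nested   : ∀ c e c′ e′ → Act F c e → Act F c′ e′ → c < c′ → e < e′ × ρ e ≤ℤ a c′
      active-rank≤    : ∀ c e → Act F c e → ρ e ≤ℤ r
      rank-active     : + 0 <ℤ r → ∃₂ λ c e → Act F c e × ρ e ≡ r
      area-active     : ∀ c e → Act F c e → + 0 <ℤ a c → ∃₂ λ c′ e′ → Act F c′ e′ × c′ < c × ρ e′ ≡ a c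

  invariant-init : Invariant 0 0 (+ 0) (replicate (length k) [])
  invariant-init = record
    { width           = length-replicate (length k)
    ; s≤p             = z≤n
    ; empty           = λ c _ → col-replicate (length k) c
    ; top             = λ c ()
    ; cellSpec        = λ c _ _ → ⊥-elim ∘ no-cell c
    ; top-area        = λ c _ → ⊥-elim ∘ no-cell c
    ; tops-increasing = λ c _ _ _ _ → ⊥-elim ∘ no-cell c
    ; top-least       = λ c _ _ _ → ⊥-elim ∘ no-cell c
    ; placed          = λ { x (s≤s _) () }
    ; unique          = λ c _ _ _ _ → ⊥-elim ∘ no-cell c
    ; active-nested   = λ c _ _ _ → ⊥-elim ∘ no-active c
    ; active-rank≤    = λ c _ → ⊥-elim ∘ no-active c
    ; rank-active     = λ { (+<+ ()) }
    ; area-active     = λ c _ → ⊥-elim ∘ no-active c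
    }
    where
      no-cell : ∀ c {m x} → ¬ Cell (replicate (length k) []) c m x
      no-cell c = ¬Cell-[] (replicate (length k) []) c (col-replicate (length k) c)
      no-active : ∀ c {e} → ¬ Act (replicate (length k) []) c e
      no-active c act = no-cell c (ActiveCell.cell (active⇒ActiveCell k (replicate (length k) []) c act))

  module _ {p s r F} (I : Invariant p s r F) where
    open Invariant I

    Cell⇒≤p : ∀ c m x → Cell F c m x → x ≤ p
    Cell⇒≤p c m x cell = CellSpec.entry≤ (cellSpec c m x cell)

    active⇒column< : ∀ c e → Act F c e → c < s
    active⇒column< c e act = CellSpec.column< (cellSpec c row e cell)
      where open ActiveCell (active⇒ActiveCell k F c act)

    active⇒≤p : ∀ c e → Act F c e → e ≤ p
    active⇒≤p c e act = Cell⇒≤p c row e cell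
      where open ActiveCell (active⇒ActiveCell k F c act)

    active⇒1≤p : ∀ c e → Act F c e → 1 ≤ p
    active⇒1≤p c e act = ℕ.≤-trans (CellSpec.1≤entry (cellSpec c row e cell)) (active⇒≤p c e act)
      where open ActiveCell (active⇒ActiveCell k F c act)

    area<active-rank : ∀ c e → Act F c e → a c <ℤ ρ e
    area<active-rank c e act = subst (a c <ℤ_) (sym ρe≡) (i<i+[1+n] (a c) (κ c ∸ suc row))
      where
        open ActiveCell (active⇒ActiveCell k F c act)
        ρe≡ : ρ e ≡ a c +ℤ + suc (κ c ∸ suc row)
        ρe≡ = trans (CellSpec.rank (cellSpec c row e cell)) (cong (λ n → a c +ℤ + n) (k∸m≡1+k∸[1+m] row<))

  module S-step {p s r F} (I : Invariant p s r F) (s<ℓ : s < length k) (ρp≡r : ρ p ≡ r)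
                (ρ[1+p]≡ : ρ (suc p) ≡ r +ℤ + κ s) (as≡r : a s ≡ r) (1≤κs : 1 ≤ κ s) where
    open Invariant I

    G : Tableau
    G = placeTop (suc p) F

    column-s-empty : col F s ≡ []
    column-s-empty = empty s ℕ.≤-refl

    G≈F+p : Appended F G s (suc p)
    G≈F+p = placeTop-appended (suc p) F s (λ c c<s c≡[] → ¬Cell-[] F c c≡[] (proj₂ (top c c<s)))
                               column-s-empty (subst (s <_) (sym width) s<ℓ)
    open Appended G≈F+p using (unchanged)
    open AppendedCells G≈F+p

    cell⁻ : ∀ c m x → Cell G c m x → Cell F c m x ⊎ (c ≡ s × m ≡ 0 × x ≡ suc p)
    cell⁻ c m x cell with Cell⁻ c m x cell
    ... | inj₁ old                 = inj₁ old
    ... | inj₂ (c≡s , m≡ , x≡1+p) = inj₂ (c≡s , trans m≡ (cong length column-s-empty) , x≡1+p)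

    new-top : Cell G s 0 (suc p)
    new-top = subst (λ m → Cell G s m (suc p)) (cong length column-s-empty) Cell-new

    new-active : Act G s (suc p)
    new-active = Active-new k (subst (λ n → suc n < suc (κ s)) (sym (cong length column-s-empty)) (s≤s 1≤κs))

    top′ : ∀ c → c < suc s → ∃ (Cell G c 0)
    top′ c c<1+s with ℕ.m<1+n⇒m<n∨m≡n c<1+s
    ... | inj₁ c<s  = proj₁ (top c c<s) , Cell⁺ c 0 _ (proj₂ (top c c<s))
    ... | inj₂ refl = suc p , new-top

    cellSpec′ : ∀ c m x → Cell G c m x → CellSpec (suc p) (suc s) c m x
    cellSpec′ c m x cell with cell⁻ c m x cell
    ... | inj₁ old                = CellSpec-mono (ℕ.n≤1+n p) (ℕ.n≤1+n s) (cellSpec c m x old)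
    ... | inj₂ (refl , refl , refl) = record
      { column< = ℕ.n<1+n s ; row≤ = z≤n ; 1≤entry = s≤s z≤n ; entry≤ = ℕ.≤-refl
      ; rank = trans ρ[1+p]≡ (cong (_+ℤ + κ s) (sym as≡r)) }

    top-area′ : ∀ c t → Cell G c 0 t → a c ≡ ρ (t ∸ 1)
    top-area′ c t cell with cell⁻ c 0 t cell
    ... | inj₁ old                = top-area c t old
    ... | inj₂ (refl , _ , refl) = trans as≡r (sym ρp≡r)

    tops-increasing′ : ∀ c c′ t t′ → c < c′ → Cell G c 0 t → Cell G c′ 0 t′ → t < t′
    tops-increasing′ c c′ t t′ c<c′ cell cell′ with cell⁻ c 0 t cell | cell⁻ c′ 0 t′ cell′
    ... | inj₁ old | inj₁ old′               = tops-increasing c c′ t t′ c<c′ old old′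
    ... | inj₁ old | inj₂ (refl , _ , refl) = s≤s (Cell⇒≤p I c 0 t old)
    ... | inj₂ (refl , _ , refl) | inj₁ old′ = ⊥-elim (ℕ.<-asym c<c′ (CellSpec.column< (cellSpec c′ 0 t′ old′)))
    ... | inj₂ (refl , _ , refl) | inj₂ (refl , _ , refl) = ⊥-elim (ℕ.<-irrefl refl c<c′)

    top-least′ : ∀ c m t x → Cell G c 0 t → Cell G c m x → t ≤ x
    top-least′ c m t x cell cell′ with cell⁻ c 0 t cell | cell⁻ c m x cell′
    ... | inj₁ old | inj₁ old′               = top-least c m t x old old′
    ... | inj₁ old | inj₂ (refl , _ , refl) = ⊥-elim (¬Cell-[] F s column-s-empty old)
    ... | inj₂ (refl , _ , refl) | inj₁ old′ = ⊥-elim (¬Cell-[] F s column-s-empty old′)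
    ... | inj₂ (refl , _ , refl) | inj₂ (_ , _ , refl) = ℕ.≤-refl

    placed′ : ∀ x → 1 ≤ x → x ≤ suc p → ∃₂ λ c m → Cell G c m x
    placed′ x 1≤x x≤1+p with ℕ.m≤n⇒m<n∨m≡n x≤1+p
    ... | inj₂ refl = s , 0 , new-top
    ... | inj₁ x≤p with placed x 1≤x (ℕ.≤-pred x≤p)
    ...   | c , m , cell = c , m , Cell⁺ c m x cell

    unique′ : ∀ c m c′ m′ x → Cell G c m x → Cell G c′ m′ x → c ≡ c′ × m ≡ m′
    unique′ c m c′ m′ x cell cell′ with cell⁻ c m x cell | cell⁻ c′ m′ x cell′
    ... | inj₁ old | inj₁ old′               = unique c m c′ m′ x old old′
    ... | inj₁ old | inj₂ (_ , _ , refl)    = ⊥-elim (ℕ.<-irrefl refl (Cell⇒≤p I c m x old))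
    ... | inj₂ (_ , _ , refl) | inj₁ old′    = ⊥-elim (ℕ.<-irrefl refl (Cell⇒≤p I c′ m′ x old′))
    ... | inj₂ (refl , refl , refl) | inj₂ (refl , refl , _) = refl , refl

    active-nested′ : ∀ c e c′ e′ → Act G c e → Act G c′ e′ → c < c′ → e < e′ × ρ e ≤ℤ a c′
    active-nested′ c e c′ e′ act act′ c<c′ with Active⁻ k c e act | Active⁻ k c′ e′ act′
    ... | inj₁ (_ , old) | inj₁ (_ , old′) = active-nested c e c′ e′ old old′ c<c′
    ... | inj₁ (_ , old) | inj₂ (refl , refl) =
      s≤s (active⇒≤p I c e old) , subst (ρ e ≤ℤ_) (sym as≡r) (active-rank≤ c e old)
    ... | inj₂ (refl , refl) | inj₁ (_ , old′) = ⊥-elim (ℕ.<-asym c<c′ (active⇒column< I c′ e′ old′))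
    ... | inj₂ (refl , refl) | inj₂ (refl , refl) = ⊥-elim (ℕ.<-irrefl refl c<c′)

    active-rank≤′ : ∀ c e → Act G c e → ρ e ≤ℤ r +ℤ + κ s
    active-rank≤′ c e act with Active⁻ k c e act
    ... | inj₁ (_ , old)     = ℤ.≤-trans (active-rank≤ c e old) (ℤ.i≤i+j r (+ κ s))
    ... | inj₂ (refl , refl) = ℤ.≤-reflexive ρ[1+p]≡

    old-active : ∀ c′ e′ → Act F c′ e′ → Act G c′ e′
    old-active c′ e′ old = Active⁺ k c′ e′ old (λ c′≡s → ℕ.<-irrefl c′≡s (active⇒column< I c′ e′ old))

    area-active′ : ∀ c e → Act G c e → + 0 <ℤ a c → ∃₂ λ c′ e′ → Act G c′ e′ × c′ < c × ρ e′ ≡ a c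
    area-active′ c e act 0<ac with Active⁻ k c e act
    ... | inj₁ (_ , old) with area-active c e old 0<ac
    ...   | c′ , e′ , old′ , c′<c , ρe′≡ = c′ , e′ , old-active c′ e′ old′ , c′<c , ρe′≡
    area-active′ c e act 0<ac | inj₂ (refl , refl) with rank-active (subst (+ 0 <ℤ_) as≡r 0<ac)
    ...   | c′ , e′ , old′ , ρe′≡r =
      c′ , e′ , old-active c′ e′ old′ , active⇒column< I c′ e′ old′ , trans ρe′≡r (sym as≡r)

    invariant-S : Invariant (suc p) (suc s) (r +ℤ + κ s) (placeTop (suc p) F)
    invariant-S = record
      { width           = trans (length-placeTop (suc p) F) width
      ; s≤p             = s≤s s≤p
      ; empty           = λ c s<c → trans (unchanged c (λ c≡s → ℕ.<-irrefl (sym c≡s) s<c)) (empty c (ℕ.<⇒≤ s<c))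
      ; top             = top′
      ; cellSpec        = cellSpec′
      ; top-area        = top-area′
      ; tops-increasing = tops-increasing′
      ; top-least       = top-least′
      ; placed          = placed′
      ; unique          = unique′
      ; active-nested   = active-nested′
      ; active-rank≤    = active-rank≤′
      ; rank-active     = λ _ → s , suc p , new-active , ρ[1+p]≡
      ; area-active     = area-active′
      }

  -- Some active entry sits at the current rank r; by nesting, entries and ranks of active entries
  -- increase together, so the largest active entry is the one at rank r.
  largestActive-at-rank : ∀ {p s r F} → Invariant p s r F → + 0 <ℤ r →
    ∃₂ λ c₀ e → largestActive k F ≡ just e × Act F c₀ e × ρ e ≡ r × (∀ c e′ → Act F c e′ → e′ ≤ e)
  largestActive-at-rank {r = r} {F} I 0<r with Invariant.rank-active I 0<r
  ... | c* , e* , act* , ρe*≡r with active≤largestActive k F c* act*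
  ...   | e , largest , e*≤e with largestActive-active k F largest
  ...     | c₀ , act₀ = c₀ , e , largest , act₀ , ρe≡r , maximal
    where
      open Invariant I
      maximal : ∀ c e′ → Act F c e′ → e′ ≤ e
      maximal c e′ act with active≤largestActive k F c act
      ... | e″ , largest″ , e′≤e″ = subst (e′ ≤_) (just-injective (trans (sym largest″) largest)) e′≤e″
      ρe≡r : ρ e ≡ r
      ρe≡r with ℕ.<-cmp c* c₀
      ... | tri< c*<c₀ _ _ = ⊥-elim (ℤ.<-irrefl refl (subst (ρ e* <ℤ_) (sym ρe*≡r)
              (ℤ.<-≤-trans (ℤ.≤-<-trans (proj₂ (active-nested c* e* c₀ e act* act₀ c*<c₀))
                                        (area<active-rank I c₀ e act₀))
                           (active-rank≤ c₀ e act₀))))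
      ... | tri≈ _ refl _ = trans (cong ρ (just-injective (trans (sym (proj₁ act₀)) (proj₁ act*)))) ρe*≡r
      ... | tri> _ _ c₀<c* =
        ⊥-elim (ℕ.<-irrefl refl (ℕ.<-≤-trans (proj₁ (active-nested c₀ e c* e* act₀ act* c₀<c*)) e*≤e))

  module W-step {p s r F} (I : Invariant p s r F) (ρ[1+p]≡ : ρ (suc p) ≡ r -ℤ + 1) (c₀ e : ℕ) (act₀ : Act F c₀ e)
                (ρe≡r : ρ e ≡ r) (maximal : ∀ c e′ → Act F c e′ → e′ ≤ e) where
    open Invariant I

    G : Tableau
    G = placeBelow e (suc p) F
    open ActiveCell (active⇒ActiveCell k F c₀ act₀) renaming (row to m₀; bottom to len₀; cell to cell₀; row< to m₀<κ)

    c₀<s : c₀ < s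
    c₀<s = active⇒column< I c₀ e act₀

    G≈F+p : Appended F G c₀ (suc p)
    G≈F+p = placeBelow-appended e (suc p) F c₀ (λ c m cell → proj₁ (unique c m c₀ m₀ e cell cell₀)) (proj₁ act₀)
    open Appended G≈F+p using (unchanged)
    open AppendedCells G≈F+p

    ρ[1+p]≡row : ρ (suc p) ≡ a c₀ +ℤ + (κ c₀ ∸ suc m₀)
    ρ[1+p]≡row = begin
      ρ (suc p)                                 ≡⟨ ρ[1+p]≡ ⟩
      r -ℤ + 1                                  ≡⟨ cong (_-ℤ + 1) (sym ρe≡r) ⟩
      ρ e -ℤ + 1                                ≡⟨ cong (_-ℤ + 1) (CellSpec.rank (cellSpec c₀ m₀ e cell₀)) ⟩
      (a c₀ +ℤ + (κ c₀ ∸ m₀)) -ℤ + 1            ≡⟨ cong (λ n → (a c₀ +ℤ + n) -ℤ + 1) (k∸m≡1+k∸[1+m] m₀<κ) ⟩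
      (a c₀ +ℤ + suc (κ c₀ ∸ suc m₀)) -ℤ + 1    ≡⟨ i+[1+n]-1≡i+n (a c₀) _ ⟩
      a c₀ +ℤ + (κ c₀ ∸ suc m₀)                 ∎
      where open ≡-Reasoning

    a₀≤r-1 : a c₀ ≤ℤ r -ℤ + 1
    a₀≤r-1 = subst (a c₀ ≤ℤ_) (trans (sym ρ[1+p]≡row) ρ[1+p]≡) (ℤ.i≤i+j (a c₀) (+ (κ c₀ ∸ suc m₀)))

    ¬active-right : ∀ c e′ → Act F c e′ → ¬ (c₀ < c)
    ¬active-right c e′ act c₀<c =
      ℕ.<-irrefl refl (ℕ.<-≤-trans (proj₁ (active-nested c₀ e c e′ act₀ act c₀<c)) (maximal c e′ act))

    cell⁻ : ∀ c m x → Cell G c m x → Cell F c m x ⊎ (c ≡ c₀ × m ≡ suc m₀ × x ≡ suc p)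
    cell⁻ c m x cell with Cell⁻ c m x cell
    ... | inj₁ old                   = inj₁ old
    ... | inj₂ (c≡c₀ , m≡ , x≡1+p) = inj₂ (c≡c₀ , trans m≡ (sym len₀) , x≡1+p)

    old-top : ∀ c t → Cell G c 0 t → Cell F c 0 t
    old-top c t cell with cell⁻ c 0 t cell
    ... | inj₁ old = old

    new-cell : Cell G c₀ (suc m₀) (suc p)
    new-cell = subst (λ m → Cell G c₀ m (suc p)) (sym len₀) Cell-new

    cellSpec′ : ∀ c m x → Cell G c m x → CellSpec (suc p) s c m x
    cellSpec′ c m x cell with cell⁻ c m x cell
    ... | inj₁ old                  = CellSpec-mono (ℕ.n≤1+n p) ℕ.≤-refl (cellSpec c m x old)
    ... | inj₂ (refl , refl , refl) = record
      { column< = c₀<s ; row≤ = m₀<κ ; 1≤entry = s≤s z≤n ; entry≤ = ℕ.≤-refl ; rank = ρ[1+p]≡row }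

    top-least′ : ∀ c m t x → Cell G c 0 t → Cell G c m x → t ≤ x
    top-least′ c m t x cell cell′ with cell⁻ c m x cell′
    ... | inj₁ old              = top-least c m t x (old-top c t cell) old
    ... | inj₂ (refl , _ , refl) = ℕ.m≤n⇒m≤1+n (Cell⇒≤p I c 0 t (old-top c t cell))

    placed′ : ∀ x → 1 ≤ x → x ≤ suc p → ∃₂ λ c m → Cell G c m x
    placed′ x 1≤x x≤1+p with ℕ.m≤n⇒m<n∨m≡n x≤1+p
    ... | inj₂ refl = c₀ , suc m₀ , new-cell
    ... | inj₁ x≤p with placed x 1≤x (ℕ.≤-pred x≤p)
    ...   | c , m , cell = c , m , Cell⁺ c m x cell

    unique′ : ∀ c m c′ m′ x → Cell G c m x → Cell G c′ m′ x → c ≡ c′ × m ≡ m′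
    unique′ c m c′ m′ x cell cell′ with cell⁻ c m x cell | cell⁻ c′ m′ x cell′
    ... | inj₁ old | inj₁ old′               = unique c m c′ m′ x old old′
    ... | inj₁ old | inj₂ (_ , _ , refl)    = ⊥-elim (ℕ.<-irrefl refl (Cell⇒≤p I c m x old))
    ... | inj₂ (_ , _ , refl) | inj₁ old′    = ⊥-elim (ℕ.<-irrefl refl (Cell⇒≤p I c′ m′ x old′))
    ... | inj₂ (refl , refl , refl) | inj₂ (refl , refl , _) = refl , refl

    active-left : ∀ c e′ → Act F c e′ → c ≢ c₀ → c < c₀
    active-left c e′ act c≢c₀ with ℕ.<-cmp c c₀
    ... | tri< c<c₀ _ _ = c<c₀
    ... | tri≈ _ c≡c₀ _ = ⊥-elim (c≢c₀ c≡c₀)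
    ... | tri> _ _ c₀<c = ⊥-elim (¬active-right c e′ act c₀<c)

    left-active : ∀ c′ e′ → Act F c′ e′ → c′ < c₀ → Act G c′ e′
    left-active c′ e′ act c′<c₀ = Active⁺ k c′ e′ act (ℕ.<⇒≢ c′<c₀)

    active-nested′ : ∀ c e₁ c′ e₂ → Act G c e₁ → Act G c′ e₂ → c < c′ → e₁ < e₂ × ρ e₁ ≤ℤ a c′
    active-nested′ c e₁ c′ e₂ act act′ c<c′ with Active⁻ k c e₁ act | Active⁻ k c′ e₂ act′
    ... | inj₁ (_ , old) | inj₁ (_ , old′) = active-nested c e₁ c′ e₂ old old′ c<c′
    ... | inj₁ (_ , old) | inj₂ (refl , refl) =
      s≤s (active⇒≤p I c e₁ old) , proj₂ (active-nested c e₁ c₀ e old act₀ c<c′)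
    ... | inj₂ (refl , refl) | inj₁ (_ , old′) = ⊥-elim (¬active-right c′ e₂ old′ c<c′)
    ... | inj₂ (refl , refl) | inj₂ (refl , refl) = ⊥-elim (ℕ.<-irrefl refl c<c′)

    active-rank≤′ : ∀ c e₁ → Act G c e₁ → ρ e₁ ≤ℤ r -ℤ + 1
    active-rank≤′ c e₁ act with Active⁻ k c e₁ act
    ... | inj₁ (c≢c₀ , old) =
      ℤ.≤-trans (proj₂ (active-nested c e₁ c₀ e old act₀ (active-left c e₁ old c≢c₀))) a₀≤r-1
    ... | inj₂ (refl , refl) = ℤ.≤-reflexive ρ[1+p]≡

    full⇒r-1≡a₀ : ¬ (suc (length (col F c₀)) < suc (κ c₀)) → r -ℤ + 1 ≡ a c₀
    full⇒r-1≡a₀ no-room = begin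
      r -ℤ + 1                   ≡⟨ sym ρ[1+p]≡ ⟩
      ρ (suc p)                  ≡⟨ ρ[1+p]≡row ⟩
      a c₀ +ℤ + (κ c₀ ∸ suc m₀)  ≡⟨ cong (λ n → a c₀ +ℤ + n) (ℕ.m≤n⇒m∸n≡0 κ≤1+m₀) ⟩
      a c₀ +ℤ + 0                ≡⟨ ℤ.+-identityʳ (a c₀) ⟩
      a c₀                       ∎
      where
        open ≡-Reasoning
        κ≤1+m₀ : κ c₀ ≤ suc m₀
        κ≤1+m₀ = subst (κ c₀ ≤_) (sym len₀) (ℕ.≤-pred (ℕ.≮⇒≥ no-room))

    -- If the new entry fills column c₀, the current rank drops to the area of c₀, which is
    -- the rank of the active entry just left of c₀.
    rank-active′ : + 0 <ℤ r -ℤ + 1 → ∃₂ λ c e₁ → Act G c e₁ × ρ e₁ ≡ r -ℤ + 1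
    rank-active′ 0<r-1 with suc (length (col F c₀)) <? suc (κ c₀)
    ... | yes room = c₀ , suc p , Active-new k room , ρ[1+p]≡
    ... | no no-room with area-active c₀ e act₀ (subst (+ 0 <ℤ_) (full⇒r-1≡a₀ no-room) 0<r-1)
    ...   | c′ , e′ , act′ , c′<c₀ , ρe′≡ =
      c′ , e′ , left-active c′ e′ act′ c′<c₀ , trans ρe′≡ (sym (full⇒r-1≡a₀ no-room))

    area-active′ : ∀ c e₁ → Act G c e₁ → + 0 <ℤ a c → ∃₂ λ c′ e′ → Act G c′ e′ × c′ < c × ρ e′ ≡ a c
    area-active′ c e₁ act 0<ac with Active⁻ k c e₁ act
    ... | inj₂ (refl , refl) with area-active c₀ e act₀ 0<ac
    ...   | c′ , e′ , act′ , c′<c₀ , ρe′≡ = c′ , e′ , left-active c′ e′ act′ c′<c₀ , c′<c₀ , ρe′≡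
    area-active′ c e₁ act 0<ac | inj₁ (c≢c₀ , old) with area-active c e₁ old 0<ac
    ...   | c′ , e′ , act′ , c′<c , ρe′≡ =
      c′ , e′ , left-active c′ e′ act′ (ℕ.<-trans c′<c (active-left c e₁ old c≢c₀)) , c′<c , ρe′≡

    invariant-W : Invariant (suc p) s (r -ℤ + 1) (placeBelow e (suc p) F)
    invariant-W = record
      { width           = trans (length-placeBelow e (suc p) F) width
      ; s≤p             = ℕ.m≤n⇒m≤1+n s≤p
      ; empty           = λ c s≤c → trans (unchanged c (λ c≡c₀ → ℕ.<⇒≢ (ℕ.<-≤-trans c₀<s s≤c) (sym c≡c₀)))
                                          (empty c s≤c)
      ; top             = λ c c<s → proj₁ (top c c<s) , Cell⁺ c 0 _ (proj₂ (top c c<s))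
      ; cellSpec        = cellSpec′
      ; top-area        = λ c t cell → top-area c t (old-top c t cell)
      ; tops-increasing = λ c c′ t t′ c<c′ cell cell′ →
                            tops-increasing c c′ t t′ c<c′ (old-top c t cell) (old-top c′ t′ cell′)
      ; top-least       = top-least′
      ; placed          = placed′
      ; unique          = unique′
      ; active-nested   = active-nested′
      ; active-rank≤    = active-rank≤′
      ; rank-active     = rank-active′
      ; area-active     = area-active′
      }

  advance : ∀ p {r r′} ks {ks′} x π′ → drop p (ranks (+ 0) k π) ≡ ranks r ks (x ∷ π′) →
            ranks r ks (x ∷ π′) ≡ r ∷ ranks r′ ks′ π′ →
            ρ p ≡ r × ρ (suc p) ≡ r′ × drop (suc p) (ranks (+ 0) k π) ≡ ranks r′ ks′ π′
  advance p {r′ = r′} ks {ks′} x π′ suffix unfold with drop-∷ (+ 0) p _ (trans suffix unfold)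
  ... | ρp≡r , suffix′ =
    ρp≡r , proj₁ (drop-∷ (+ 0) (suc p) (ranks (+ 0) k π) (trans suffix′ (proj₂ (ranks-head r′ ks′ π′)))) , suffix′

  Filled : Tableau → Set
  Filled F = ∃ λ p → ∃ λ s → ∃ λ r → Invariant p s r F × length k ≤ s

  -- π′ is what remains of π after p letters, s of them S; ks are the exponents of the S letters of π′.
  run : ∀ π′ p s r ks F →
        drop p (ranks (+ 0) k π) ≡ ranks r ks π′ → drop s (areaSeq (+ 0) k π) ≡ areaSeq r ks π′ → drop s k ≡ ks →
        countS π′ ≡ length ks → All (+ 0 ≤ℤ_) (ranks r ks π′) → All (1 ≤_) ks →
        Invariant p s r F → Filled (fillFrom k (suc p) π′ F)
  run []       p s r []        F _ _ k-suffix _  _ _ I = p , s , r , I , drop-[]⇒≤ s k k-suffix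
  run []       p s r (_ ∷ _)   F _ _ _        () _ _ _
  run (S ∷ π′) p s r []        F _ _ _        () _ _ _
  run (S ∷ π′) p s r (κs ∷ ks) F ranks-suffix area-suffix k-suffix #S (_ ∷ nonneg) (1≤κs ∷ positive) I
    with refl , k-suffix′ ← drop-∷ 0 s k k-suffix
    rewrite step-S k p F (λ p≡0 → Invariant.empty I 0 (subst (s ≤_) p≡0 (Invariant.s≤p I)))
    = let ρp≡r , ρ[1+p]≡ , ranks-suffix′ = advance p (at 0 k s ∷ ks) S π′ ranks-suffix refl
          as≡r , area-suffix′           = drop-∷ (+ 0) s (areaSeq (+ 0) k π) area-suffix
      in run π′ (suc p) (suc s) (r +ℤ + κs) ks (placeTop (suc p) F) ranks-suffix′ area-suffix′ k-suffix′
             (ℕ.suc-injective #S) nonneg positive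
             (S-step.invariant-S I (drop-∷⇒< s k k-suffix) ρp≡r ρ[1+p]≡ as≡r 1≤κs)
  run (W ∷ π′) p s r ks F ranks-suffix area-suffix k-suffix #S nonneg positive I
    with 0<r , nonneg′ ← All-ranks-W r ks π′ nonneg
    with c₀ , e , largest , act₀ , ρe≡r , maximal ← largestActive-at-rank I 0<r
    rewrite step-W k p F (active⇒1≤p I c₀ e act₀) largest
    = let _ , ρ[1+p]≡ , ranks-suffix′ = advance p ks W π′ ranks-suffix (ranks-W r ks π′)
      in run π′ (suc p) s (r -ℤ + 1) ks (placeBelow e (suc p) F) ranks-suffix′
             (trans area-suffix (areaSeq-W r ks π′)) k-suffix #S nonneg′ positive
             (W-step.invariant-W I ρ[1+p]≡ c₀ e act₀ ρe≡r maximal)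

  filled : countS π ≡ length k → All (+ 0 ≤ℤ_) (ranks (+ 0) k π) → All (1 ≤_) k → Filled (fill k π)
  filled #S nonneg positive = run π 0 0 (+ 0) k _ refl refl refl #S nonneg positive invariant-init

  module _ {p s r} (I : Invariant p s r (fill k π)) where
    open Invariant I

    F : Tableau
    F = fill k π

    locate-Cell : ∀ i m x → Cell F i m x → locate x 0 F ≡ just (i , suc m)
    locate-Cell i m x cell with locate x 0 F in found
    ... | nothing = ⊥-elim (locate-nothing x 0 F found i m cell)
    ... | just (c′ , m′) with locate-just x 0 F found
    ...   | d , refl , j , refl , cell′ with unique d j i m x cell′ cell
    ...     | refl , refl = refl

    depth≡topRank : ∀ j → j < length k → depth k π j ≡ topRank F (topRanks F j) j
    depth≡topRank j = at-topRanks F j (length k)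

    top-predecessor : ∀ j → 1 ≤ j → j < s → ∃ λ t → Cell F j 0 (suc t) × 1 ≤ t
    top-predecessor j 1≤j j<s with top j j<s | top 0 (ℕ.<-trans 1≤j j<s)
    ... | zero  , top-j | t₀ , top-0 = ⊥-elim (ℕ.n≮0 (tops-increasing 0 j t₀ 0 1≤j top-0 top-j))
    ... | suc t , top-j | t₀ , top-0 =
      t , top-j , ℕ.≤-trans (CellSpec.1≤entry (cellSpec 0 0 t₀ top-0))
                            (ℕ.≤-pred (tops-increasing 0 j t₀ (suc t) 1≤j top-0 top-j))

    predecessor-left : ∀ j t i m → Cell F j 0 (suc t) → Cell F i m t → i < j
    predecessor-left j t i m top-j cell with ℕ.<-cmp i j
    ... | tri< i<j _ _ = i<j
    ... | tri≈ _ refl _ = ⊥-elim (ℕ.<-irrefl refl (top-least i m (suc t) t top-j cell))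
    ... | tri> _ _ j<i =
      let tᵢ , top-i = top i (CellSpec.column< (cellSpec i m t cell))
      in ⊥-elim (ℕ.<-irrefl refl (ℕ.<-≤-trans (ℕ.<-trans (ℕ.n<1+n t) (tops-increasing j i (suc t) tᵢ j<i top-j top-i))
                                             (top-least i m tᵢ t top-i cell)))

    area-recurrence : ∀ j t i m → Cell F j 0 (suc t) → Cell F i m t → a j ≡ ((a i +ℤ + κ i) -ℤ + suc m) +ℤ + 1
    area-recurrence j t i m top-j cell = begin
      a j                                   ≡⟨ top-area j (suc t) top-j ⟩
      ρ t                                   ≡⟨ CellSpec.rank spec ⟩
      a i +ℤ + (κ i ∸ m)                    ≡⟨ i+[k∸m]≡i+k-[1+m]+1 (a i) (CellSpec.row≤ spec) ⟩
      ((a i +ℤ + κ i) -ℤ + suc m) +ℤ + 1    ∎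
      where
        open ≡-Reasoning
        spec : CellSpec p s i m t
        spec = cellSpec i m t cell

    depth-recurrence : ∀ j t i m → j < length k → Cell F j 0 (suc t) → Cell F i m t → i < j →
                       depth k π j ≡ (depth k π i + suc m) ∸ 1
    depth-recurrence (suc n) t i m j<ℓ top-j cell i<j = begin
      depth k π (suc n)                       ≡⟨ depth≡topRank (suc n) j<ℓ ⟩
      topRank F (topRanks F (suc n)) (suc n)  ≡⟨ topRank-located F _ n (trans (cellAt≡nth-col F (suc n) 0) top-j)
                                                                     (locate-Cell i m t cell) i<j ⟩
      at 0 (topRanks F (suc n)) i + m         ≡⟨ cong (_+ m) (trans (at-topRanks F i (suc n) i<j)
                                                                    (sym (depth≡topRank i (ℕ.<-trans i<j j<ℓ)))) ⟩
      depth k π i + m                         ≡⟨ cong (_∸ 1) (sym (ℕ.+-suc (depth k π i) m)) ⟩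
      (depth k π i + suc m) ∸ 1               ∎
      where open ≡-Reasoning

    later-column : length k ≤ s → ∀ j → 1 ≤ j → j < length k →
      Σ ℕ λ t → cellAt F j 1 ≡ just t × (∃₂ λ i m → cellAt F i m ≡ just (t ∸ 1))
              × (∀ i m → cellAt F i m ≡ just (t ∸ 1) →
                   i < j × a j ≡ ((a i +ℤ + κ i) -ℤ + m) +ℤ + 1 × depth k π j ≡ (depth k π i + m) ∸ 1)
    later-column ℓ≤s j 1≤j j<ℓ with top-predecessor j 1≤j (ℕ.<-≤-trans j<ℓ ℓ≤s)
    ... | t , top-j , 1≤t = suc t , trans (cellAt≡nth-col F j 0) top-j , t-placed , recurrences
      where
        t-placed : ∃₂ λ i m → cellAt F i m ≡ just t
        t-placed with placed t 1≤t (ℕ.<⇒≤ (Cell⇒≤p I j 0 (suc t) top-j))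
        ... | i , m , cell = i , suc m , trans (cellAt≡nth-col F i m) cell
        recurrences : ∀ i m → cellAt F i m ≡ just t →
                      i < j × a j ≡ ((a i +ℤ + κ i) -ℤ + m) +ℤ + 1 × depth k π j ≡ (depth k π i + m) ∸ 1
        recurrences i zero    ()
        recurrences i (suc m) at-t =
          let cell = trans (sym (cellAt≡nth-col F i m)) at-t
              i<j  = predecessor-left j t i m top-j cell
          in i<j , area-recurrence j t i m top-j cell , depth-recurrence j t i m j<ℓ top-j cell i<j

lemma4p13 : (k : List ℕ) → All (1 ≤_) k → (π : List Letter) → IsDyck k π →
    (0 < length k → (area k π 0 ≡ + 0) × (depth k π 0 ≡ 0))
    × ((j : ℕ) → 1 ≤ j → j < length k →
        Σ ℕ (λ t → (cellAt (fill k π) j 1 ≡ just t)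
          × (Σ ℕ (λ i → Σ ℕ (λ m → cellAt (fill k π) i m ≡ just (t ∸ 1))))
          × ((i m : ℕ) → cellAt (fill k π) i m ≡ just (t ∸ 1) →
              (i < j)
              × (area k π j ≡ ((area k π i +ℤ + at 0 k i) -ℤ + m) +ℤ + 1)
              × (depth k π j ≡ (depth k π i + m) ∸ 1))))
lemma4p13 k positive π (#S , _ , nonneg) with Filling.filled k π #S nonneg positive
... | _ , _ , _ , I , ℓ≤s =
  (λ 0<ℓ → area-first k π #S nonneg 0<ℓ , Filling.depth≡topRank k π I 0 0<ℓ) ,
  Filling.later-column k π I ℓ≤s
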